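{- For every integer $n\ge 1$, in the hat game with $n$ prisoners and $k=2$ extra hats there is a deterministic strategy whose success probability is $\frac14+\frac{1}{4(n+1)}$ if $n$ is even and $\frac14+\frac{1}{4(n+2)}$ if $n$ is odd; in particular, the success probability is at least $1/4$ for every $n$.
   Context: Hat game with $n$ prisoners and $k$ extra hats: prisoners numbered $1,\dots,n$ stand in a line; there are $n+k$ hats with distinct colors $1,\dots,n+k$. The warden assigns a uniformly random injective map $\{1,\dots,n\}\to\{1,\dots,n+k\}$ (prisoner $i$ gets color $x_i$; unused hats are discarded). Prisoner $i$ sees exactly $x_{i+1},\dots,x_n$. Prisoners guess their own colors in the order $1,\dots,n$, each hearing all earlier guesses; a deterministic strategy specifies each prisoner's guess as a function of what he sees and hears, agreed in advance. They win if all guesses are correct; the success probability is the fraction of the $(n+k)!/k!$ assignments on which they win. -}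

module Defs where

open import Data.Nat using (ℕ; zero; suc; _+_)
open import Data.Bool using (Bool; true; false; _∧_)
open import Data.Fin using (Fin)
open import Data.Fin.Properties using (_≟_)
open import Data.List using (List; []; _∷_; _++_; [_]; map; concatMap; allFin; length; filter)
open import Data.List.Relation.Unary.Unique.Propositional using (Unique)
open import Data.List.Relation.Unary.AllPairs using (allPairs?)
open import Relation.Nullary using (¬?; does)
open import Relation.Nullary.Decidable using (_×-dec_)
open import Relation.Unary using (Decidable)
open import Data.Product using (_×_)
open import Data.Bool using (T)

-- Colours are Fin c (c = n + k).  A colour assignment is a list
-- x = [x₁, …, xₙ] (prisoner 1 first).
--
-- A deterministic strategy: the guess of a prisoner is a function of
-- (heard, seen) where `heard` is the list of all earlier guesses
-- (g₁, …, g_{i-1}) and `seen` is the list (x_{i+1}, …, xₙ).  Since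
-- the prisoner's index i equals 1 + length heard, this covers every
-- strategy that depends on the index, what he sees and what he hears.
Strategy : ℕ → Set
Strategy c = List (Fin c) → List (Fin c) → Fin c

wins : ∀ {c} → Strategy c → List (Fin c) → List (Fin c) → Bool
wins s heard [] = true
wins s heard (x ∷ xs) = does (g ≟ x) ∧ wins s (heard ++ [ g ]) xs
  where g = s heard xs

words : (c n : ℕ) → List (List (Fin c))
words c zero = [] ∷ []
words c (suc n) = concatMap (λ x → map (x ∷_) (words c n)) (allFin c)

-- Injective assignments {1..n} → {1..n+k}: words of length n with distinct letters.
assignments : (n k : ℕ) → List (List (Fin (n + k)))
assignments n k = filter (λ xs → allPairs? (λ a b → ¬? (a ≟ b)) xs) (words (n + k) n)

winCount : (n k : ℕ) → Strategy (n + k) → ℕ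
winCount n k s = length (filter (λ xs → Data.Bool.T? (wins s [] xs)) (assignments n k))

open import Data.Rational as ℚ using (ℚ)
open import Relation.Binary.PropositionalEquality using (_≡_)
open import Data.Integer using (+_)

nat→ℚ : ℕ → ℚ
nat→ℚ m = (+ m) ℚ./ 1

-- "The success probability of s is p": p is the fraction winCount / #assignments,
-- written multiplicatively (#assignments = (n+k)!/k! > 0, so p is unique).
SuccessProb : (n k : ℕ) → Strategy (n + k) → ℚ → Set
SuccessProb n k s p = nat→ℚ (winCount n k s) ≡ p ℚ.* nat→ℚ (length (assignments n k))

-- Index the colours 0, …, n + 1 and call a colour even or odd by its index.  An injective
-- assignment x leaves two colours unused; call x a codeword if one of them, e, is even, the
-- other, o, is odd, and the permutation x ++ [ e , o ] of all colours is even.  Two codewords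
-- never differ in exactly one position: if they carry a and b there, then a and b have the
-- parity opposite to the third colour w in play, so the two completed permutations differ by
-- the transposition of a and b.  Hence each prisoner, betting on a codeword, can name his colour
-- from what he sees and hears, and the team wins exactly on the codewords.  Half of the E·O·n!
-- assignments leaving an even and an odd colour unused (E, O the numbers of even and odd
-- colours) are codewords, as exchanging the first two hats shows for n ≥ 2; so the team wins on
-- E·O·n!/2 of the (n + 2)!/2 assignments, a fraction E·O/((n + 1)(n + 2)), which is the stated
-- probability.

module Submission where

open import Algebra.Bundles using (CommutativeMonoid; CommutativeRing; Semiring)
open import Data.Bool using (Bool; true; false; not; _∧_; _xor_; if_then_else_)
open import Data.Bool.ListAction using (all)
open import Data.Bool.Properties
  using (xor-∧-commutativeRing; xor-assoc; xor-identityʳ; xor-inverseʳ; xor-same; ∧-comm; ∧-assoc;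
         ∧-zeroʳ; ∧-identityʳ; ∧-conicalˡ; ∧-conicalʳ; not-involutive; ¬-not; T-≡; ⇔→≡)
open import Data.Bool.Solver using (module xor-∧-Solver)
open import Data.Empty using (⊥; ⊥-elim)
open import Data.Fin using (Fin; zero; suc; _↑ʳ_)
open import Data.Fin.Properties using (_≟_; any?)
open import Data.List
  using (List; []; _∷_; _++_; [_]; length; map; concatMap; tabulate; filter; head; _∷ʳ′_; initLast)
open import Data.List.Properties using (++-assoc; ++-identityʳ)
open import Data.List.Relation.Unary.All as All using (All; []; _∷_)
open import Data.List.Relation.Unary.AllPairs using (allPairs?)
open import Data.Maybe using (fromMaybe)
open import Data.Nat using (ℕ; zero; suc; _+_; _*_; _≤_; _≡ᵇ_; _!; ⌊_/2⌋; ⌈_/2⌉; NonZero)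
open import Data.Nat.Divisibility using (_∣_; divides; ∣1⇒≡1; ∣m+n∣m⇒∣n)
open import Data.Nat.Properties
  using (+-*-semiring; +-assoc; +-comm; +-suc; +-identityʳ; +-cancelʳ-≡; *-identityˡ; *-identityʳ; *-comm;
         *-assoc; *-cancelˡ-≡; suc-injective; ≡ᵇ⇒≡; n≡⌊n+n/2⌋)
open import Data.Nat.Tactic.RingSolver using (solve-∀)
open import Data.Product using (Σ; ∃; _×_; _,_; proj₁; proj₂)
open import Data.Sum using (_⊎_; inj₁; inj₂)
open import Function using (_∘_; Equivalence; mk⇔)
open import Level using (0ℓ)
open import Relation.Binary.PropositionalEquality
  using (_≡_; _≢_; _≗_; refl; sym; trans; cong; cong₂; subst; subst₂; module ≡-Reasoning)
open import Relation.Nullary using (does; yes; no; ¬_; ¬?)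
open import Relation.Nullary.Decidable using (dec-true; dec-false; T?)
open import Relation.Unary using (Decidable)

open import Defs using (Strategy; wins; words; assignments; winCount; SuccessProb; nat→ℚ)

open xor-∧-Solver using (solve; _:=_; _:+_; _:*_; con)

private variable
  k : ℕ

eqᵇ : Fin k → Fin k → Bool
eqᵇ a b = does (a ≟ b)

ltᵇ : Fin k → Fin k → Bool
ltᵇ zero    zero    = false
ltᵇ zero    (suc _) = true
ltᵇ (suc _) zero    = false
ltᵇ (suc a) (suc b) = ltᵇ a b

evenᵇ : Fin k → Bool
evenᵇ zero    = true
evenᵇ (suc a) = not (evenᵇ a)

𝟙 : Bool → ℕ
𝟙 true  = 1
𝟙 false = 0

eqᵇ-refl : (a : Fin k) → eqᵇ a a ≡ true
eqᵇ-refl a = dec-true (a ≟ a) refl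

eqᵇ-≢ : {a b : Fin k} → a ≢ b → eqᵇ a b ≡ false
eqᵇ-≢ {a = a} {b} = dec-false (a ≟ b)

eqᵇ⇒≡ : {a b : Fin k} → eqᵇ a b ≡ true → a ≡ b
eqᵇ⇒≡ {a = a} {b} e with a ≟ b
... | yes a≡b = a≡b

eqᵇ-sym : (a b : Fin k) → eqᵇ a b ≡ eqᵇ b a
eqᵇ-sym a b with a ≟ b | b ≟ a
... | yes _   | yes _   = refl
... | no  _   | no  _   = refl
... | yes a≡b | no  b≢a = ⊥-elim (b≢a (sym a≡b))
... | no  a≢b | yes b≡a = ⊥-elim (a≢b (sym b≡a))

ltᵇ-irrefl : (a : Fin k) → ltᵇ a a ≡ false
ltᵇ-irrefl zero    = refl
ltᵇ-irrefl (suc a) = ltᵇ-irrefl a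

ltᵇ-flip : {a b : Fin k} → a ≢ b → ltᵇ b a ≡ not (ltᵇ a b)
ltᵇ-flip {a = zero}  {zero}  a≢b = ⊥-elim (a≢b refl)
ltᵇ-flip {a = zero}  {suc b} _   = refl
ltᵇ-flip {a = suc a} {zero}  _   = refl
ltᵇ-flip {a = suc a} {suc b} a≢b = ltᵇ-flip (a≢b ∘ cong suc)

xor-isolateˡ : {x y z : Bool} → x xor y ≡ z → x ≡ y xor z
xor-isolateˡ {x} {y} refl = solve 2 (λ x y → x := y :+ (x :+ y)) refl x y

xor-isolateʳ : {x y z : Bool} → x xor y ≡ z → y ≡ x xor z
xor-isolateʳ {x} {y} refl = solve 2 (λ x y → y := x :+ (x :+ y)) refl x y

FinSet : ℕ → Set
FinSet k = Fin k → Bool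

full : FinSet k
full _ = true

_∖_ : FinSet k → Fin k → FinSet k
(A ∖ c) d = A d ∧ not (eqᵇ d c)

∖-comm : (A : FinSet k) (a b : Fin k) → (A ∖ a) ∖ b ≗ (A ∖ b) ∖ a
∖-comm A a b d = swap (A d) (not (eqᵇ d a)) (not (eqᵇ d b))
  where
  swap : ∀ x y z → (x ∧ y) ∧ z ≡ (x ∧ z) ∧ y
  swap = solve 3 (λ x y z → (x :* y) :* z := (x :* z) :* y) refl

∖-cong : {A B : FinSet k} → A ≗ B → (c : Fin k) → A ∖ c ≗ B ∖ c
∖-cong A≗B c d = cong (_∧ not (eqᵇ d c)) (A≗B d)

∖-self : (A : FinSet k) (c : Fin k) → (A ∖ c) c ≡ false
∖-self A c rewrite eqᵇ-refl c = ∧-zeroʳ (A c)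

∖-other : (A : FinSet k) {c d : Fin k} → A d ≡ true → d ≢ c → (A ∖ c) d ≡ true
∖-other A Ad d≢c rewrite Ad | eqᵇ-≢ d≢c = refl

∖-sub : (A : FinSet k) {c d : Fin k} → (A ∖ c) d ≡ true → A d ≡ true
∖-sub A {d = d} e with A d
... | true = refl

∖-≢ : (A : FinSet k) {c d : Fin k} → (A ∖ c) d ≡ true → d ≢ c
∖-≢ A {d = d} e refl rewrite ∖-self A d with () ← e

-- Sums over subsets of Fin k

module SubsetSum (M : CommutativeMonoid 0ℓ 0ℓ) where

  open CommutativeMonoid M
    using (Carrier; _≈_; setoid; identityˡ; identityʳ; ∙-congˡ; ∙-congʳ)
    renaming (_∙_ to _+ₘ_; ε to 0ₘ; refl to ≈-refl; sym to ≈-sym; trans to ≈-trans)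
  open import Algebra.Properties.CommutativeMonoid.Sum M using (sum; sum-cong-≋; sum-cong-≗; ∑-distrib-+; ∑-comm)
  open import Relation.Binary.Reasoning.Setoid setoid

  infix 10 ∑[_]_
  ∑[_]_ : FinSet k → (Fin k → Carrier) → Carrier
  ∑[ A ] f = sum (λ d → if A d then f d else 0ₘ)

  ∑-cong-∈ : (A : FinSet k) {f g : Fin k → Carrier} →
             (∀ d → A d ≡ true → f d ≈ g d) → ∑[ A ] f ≈ ∑[ A ] g
  ∑-cong-∈ A {f} {g} f≈g = sum-cong-≋ pointwise
    where
    pointwise : ∀ d → (if A d then f d else 0ₘ) ≈ (if A d then g d else 0ₘ)
    pointwise d with A d in Ad
    ... | true  = f≈g d Ad
    ... | false = ≈-refl

  ∑-cong-≗ : {A B : FinSet k} (f : Fin k → Carrier) → A ≗ B → ∑[ A ] f ≡ ∑[ B ] f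
  ∑-cong-≗ f A≗B = sum-cong-≗ (λ d → cong (λ b → if b then f d else 0ₘ) (A≗B d))

  ∑-+ : (A : FinSet k) (f g : Fin k → Carrier) → ∑[ A ] (λ d → f d +ₘ g d) ≈ ∑[ A ] f +ₘ ∑[ A ] g
  ∑-+ A f g =
    ≈-trans (sum-cong-≋ split) (∑-distrib-+ (λ d → if A d then f d else 0ₘ) (λ d → if A d then g d else 0ₘ))
    where
    split : ∀ d → (if A d then f d +ₘ g d else 0ₘ) ≈ (if A d then f d else 0ₘ) +ₘ (if A d then g d else 0ₘ)
    split d with A d
    ... | true  = ≈-refl
    ... | false = ≈-sym (identityˡ 0ₘ)

  ∑-empty : (A : FinSet k) (f : Fin k → Carrier) → (∀ d → A d ≡ false) → ∑[ A ] f ≈ 0ₘ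
  ∑-empty {k = zero}  A f empty = ≈-refl
  ∑-empty {k = suc k} A f empty rewrite empty zero =
    ≈-trans (identityˡ _) (∑-empty (A ∘ suc) (f ∘ suc) (empty ∘ suc))

  ∑-point : (a : Fin k) (f : Fin k → Carrier) → sum (λ d → if eqᵇ d a then f d else 0ₘ) ≈ f a
  ∑-point {k = suc k} zero    f =
    ≈-trans (∙-congˡ (∑-empty (λ _ → false) (f ∘ suc) (λ _ → refl))) (identityʳ (f zero))
  ∑-point {k = suc k} (suc a) f = ≈-trans (identityˡ _) (∑-point a (f ∘ suc))

  ∑-remove : (A : FinSet k) (f : Fin k → Carrier) {a : Fin k} → A a ≡ true →
             ∑[ A ] f ≈ f a +ₘ ∑[ A ∖ a ] f
  ∑-remove A f {a} Aa = begin
    ∑[ A ] f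
      ≈⟨ sum-cong-≋ split ⟩
    sum (λ d → (if eqᵇ d a then f d else 0ₘ) +ₘ (if (A ∖ a) d then f d else 0ₘ))
      ≈⟨ ∑-distrib-+ (λ d → if eqᵇ d a then f d else 0ₘ) (λ d → if (A ∖ a) d then f d else 0ₘ) ⟩
    sum (λ d → if eqᵇ d a then f d else 0ₘ) +ₘ ∑[ A ∖ a ] f
      ≈⟨ ∙-congʳ (∑-point a f) ⟩
    f a +ₘ ∑[ A ∖ a ] f ∎
    where
    split : ∀ d → (if A d then f d else 0ₘ) ≈ (if eqᵇ d a then f d else 0ₘ) +ₘ (if (A ∖ a) d then f d else 0ₘ)
    split d with eqᵇ d a in d=a | A d in Ad
    ... | true  | true  = ≈-sym (identityʳ _)
    ... | true  | false with () ← trans (sym Ad) (trans (cong A (eqᵇ⇒≡ d=a)) Aa)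
    ... | false | true  = ≈-sym (identityˡ _)
    ... | false | false = ≈-sym (identityˡ _)

  ∑-pair : (A : FinSet k) (f : Fin k → Carrier) {a b : Fin k} →
           A a ≡ true → (A ∖ a) b ≡ true → (∀ d → ((A ∖ a) ∖ b) d ≡ false) →
           ∑[ A ] f ≈ f a +ₘ f b
  ∑-pair A f {a} {b} Aa Ab empty = begin
    ∑[ A ] f                            ≈⟨ ∑-remove A f Aa ⟩
    f a +ₘ ∑[ A ∖ a ] f                 ≈⟨ ∙-congˡ (∑-remove (A ∖ a) f Ab) ⟩
    f a +ₘ (f b +ₘ ∑[ (A ∖ a) ∖ b ] f)  ≈⟨ ∙-congˡ (∙-congˡ (∑-empty ((A ∖ a) ∖ b) f empty)) ⟩
    f a +ₘ (f b +ₘ 0ₘ)                  ≈⟨ ∙-congˡ (identityʳ (f b)) ⟩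
    f a +ₘ f b                          ∎

  ∑-comm-pairs : (A : FinSet k) (F : Fin k → Fin k → Carrier) →
                 ∑[ A ] (λ c → ∑[ A ∖ c ] (F c)) ≈ ∑[ A ] (λ d → ∑[ A ∖ d ] (λ c → F c d))
  ∑-comm-pairs {k} A F = begin
    sum (λ c → if A c then sum (λ d → if (A ∖ c) d then F c d else 0ₘ) else 0ₘ)
      ≈⟨ sum-cong-≋ (λ c → pull c) ⟩
    sum (λ c → sum (λ d → G c d))
      ≈⟨ ∑-comm G ⟩
    sum (λ d → sum (λ c → G c d))
      ≈⟨ sum-cong-≋ (λ d → ≈-sym (≈-trans (pull d) (sum-cong-≋ (λ c → swap c d)))) ⟩
    sum (λ d → if A d then sum (λ c → if (A ∖ d) c then F c d else 0ₘ) else 0ₘ) ∎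
    where
    G : Fin k → Fin k → Carrier
    G c d = if A c ∧ (A ∖ c) d then F c d else 0ₘ
    pull : ∀ c {h : Fin k → Carrier} →
           (if A c then sum (λ d → if (A ∖ c) d then h d else 0ₘ) else 0ₘ) ≈
           sum (λ d → if A c ∧ (A ∖ c) d then h d else 0ₘ)
    pull c {h} with A c
    ... | true  = ≈-refl
    ... | false = ≈-sym (∑-empty (λ _ → false) h (λ _ → refl))
    swap : ∀ c d → (if A d ∧ (A ∖ d) c then F c d else 0ₘ) ≈ G c d
    swap c d rewrite eqᵇ-sym c d with A c | A d
    ... | true  | true  = ≈-refl
    ... | true  | false = ≈-refl
    ... | false | true  = ≈-refl
    ... | false | false = ≈-refl

open SubsetSum (Semiring.+-commutativeMonoid +-*-semiring)
open SubsetSum (CommutativeRing.+-commutativeMonoid xor-∧-commutativeRing)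
  using ()
  renaming (∑[_]_ to ⨁[_]_; ∑-cong-∈ to ⨁-cong-∈; ∑-cong-≗ to ⨁-cong-≗;
            ∑-remove to ⨁-remove; ∑-pair to ⨁-pair)

∑-*ʳ : (A : FinSet k) (f : Fin k → ℕ) (x : ℕ) → ∑[ A ] (λ d → f d * x) ≡ ∑[ A ] f * x
∑-*ʳ A f x = trans (sum-cong-≗ pointwise) (sym (*-distribʳ-sum x (λ d → if A d then f d else 0)))
  where
  open import Algebra.Properties.Semiring.Sum +-*-semiring using (sum-cong-≗; *-distribʳ-sum)
  pointwise : ∀ d → (if A d then f d * x else 0) ≡ (if A d then f d else 0) * x
  pointwise d with A d
  ... | true  = refl
  ... | false = refl

size : FinSet k → ℕ
size A = ∑[ A ] (λ _ → 1)

evens odds : FinSet k → ℕ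
evens A = ∑[ A ] (λ d → 𝟙 (evenᵇ d))
odds  A = ∑[ A ] (λ d → 𝟙 (not (evenᵇ d)))

∑-const : (A : FinSet k) (x : ℕ) → ∑[ A ] (λ _ → x) ≡ size A * x
∑-const A x = trans (∑-cong-∈ A (λ _ _ → sym (*-identityˡ x))) (∑-*ʳ A (λ _ → 1) x)

size≡evens+odds : (A : FinSet k) → size A ≡ evens A + odds A
size≡evens+odds A = trans (∑-cong-∈ A (λ d _ → one d)) (∑-+ A _ _)
  where
  one : ∀ d → 1 ≡ 𝟙 (evenᵇ d) + 𝟙 (not (evenᵇ d))
  one d with evenᵇ d
  ... | true  = refl
  ... | false = refl

size-∖ : (A : FinSet k) {a : Fin k} → A a ≡ true → size A ≡ suc (size (A ∖ a))
size-∖ A Aa = ∑-remove A (λ _ → 1) Aa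

size≡0⇒empty : (A : FinSet k) → size A ≡ 0 → ∀ d → A d ≡ false
size≡0⇒empty A size≡0 d with A d in Ad
... | false = refl
... | true with () ← trans (sym (size-∖ A Ad)) size≡0

size≡suc⇒member : (A : FinSet k) {m : ℕ} → size A ≡ suc m → ∃ λ d → A d ≡ true
size≡suc⇒member A size≡suc with any? (λ d → A d Data.Bool.≟ true)
... | yes member = member
... | no  none   with () ← trans (sym (∑-empty A (λ _ → 1) (λ d → ¬-not (λ Ad → none (d , Ad))))) size≡suc

-- The code

_∖*_ : FinSet k → List (Fin k) → FinSet k
A ∖* []      = A
A ∖* (c ∷ w) = (A ∖ c) ∖* w

distinctIn : FinSet k → List (Fin k) → Bool
distinctIn A []      = true
distinctIn A (c ∷ w) = A c ∧ distinctIn (A ∖ c) w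

rank : FinSet k → Fin k → Bool
rank A c = ⨁[ A ] (λ d → ltᵇ d c)

sign : FinSet k → List (Fin k) → Bool
sign A []      = false
sign A (c ∷ w) = rank A c xor sign (A ∖ c) w

closing : FinSet k → Bool
closing A = ⨁[ A ] (λ d → evenᵇ d ∧ rank A d)

Final : FinSet k → Bool → Bool
Final A t = (evens A ≡ᵇ 1) ∧ ((odds A ≡ᵇ 1) ∧ not (t xor closing A))

-- Code A w t: w lists distinct colours of A, the two colours left over are an even one e and an
-- odd one o, and the arrangement w ++ [ e , o ] of A has sign t (the parity of its Lehmer code).
Code : FinSet k → List (Fin k) → Bool → Bool
Code A w t = distinctIn A w ∧ Final (A ∖* w) (t xor sign A w)

Code-∷ : (A : FinSet k) (c : Fin k) (w : List (Fin k)) (t : Bool) →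
         Code A (c ∷ w) t ≡ A c ∧ Code (A ∖ c) w (t xor rank A c)
Code-∷ A c w t =
  trans (∧-assoc (A c) (distinctIn (A ∖ c) w) _)
        (cong (λ s → A c ∧ (distinctIn (A ∖ c) w ∧ Final ((A ∖ c) ∖* w) s))
              (sym (xor-assoc t (rank A c) (sign (A ∖ c) w))))

rank-∖ : (A : FinSet k) {a : Fin k} → A a ≡ true → (c : Fin k) → rank A c ≡ ltᵇ a c xor rank (A ∖ a) c
rank-∖ A Aa c = ⨁-remove A (λ d → ltᵇ d c) Aa

rank-∖-xor : (A : FinSet k) {a : Fin k} → A a ≡ true → (c : Fin k) → rank (A ∖ a) c ≡ ltᵇ a c xor rank A c
rank-∖-xor A {a} Aa c = xor-isolateʳ {ltᵇ a c} {rank (A ∖ a) c} (sym (rank-∖ A Aa c))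

rank-cong : {A B : FinSet k} → A ≗ B → (c : Fin k) → rank A c ≡ rank B c
rank-cong A≗B c = ⨁-cong-≗ (λ d → ltᵇ d c) A≗B

closing-cong : {A B : FinSet k} → A ≗ B → closing A ≡ closing B
closing-cong {A = A} {B} A≗B =
  trans (⨁-cong-≗ (λ d → evenᵇ d ∧ rank A d) A≗B) (⨁-cong-∈ B (λ d _ → cong (evenᵇ d ∧_) (rank-cong A≗B d)))

Final-cong : {A B : FinSet k} → A ≗ B → (t : Bool) → Final A t ≡ Final B t
Final-cong A≗B t =
  cong₂ (λ e rest → (e ≡ᵇ 1) ∧ rest) (∑-cong-≗ (λ d → 𝟙 (evenᵇ d)) A≗B)
    (cong₂ (λ o c → (o ≡ᵇ 1) ∧ not (t xor c)) (∑-cong-≗ (λ d → 𝟙 (not (evenᵇ d))) A≗B) (closing-cong A≗B))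

∖*-cong : {A B : FinSet k} → A ≗ B → (w : List (Fin k)) → A ∖* w ≗ B ∖* w
∖*-cong A≗B []      = A≗B
∖*-cong A≗B (c ∷ w) = ∖*-cong (∖-cong A≗B c) w

distinctIn-cong : {A B : FinSet k} → A ≗ B → (w : List (Fin k)) → distinctIn A w ≡ distinctIn B w
distinctIn-cong A≗B []      = refl
distinctIn-cong A≗B (c ∷ w) = cong₂ _∧_ (A≗B c) (distinctIn-cong (∖-cong A≗B c) w)

sign-cong : {A B : FinSet k} → A ≗ B → (w : List (Fin k)) → sign A w ≡ sign B w
sign-cong A≗B []      = refl
sign-cong A≗B (c ∷ w) = cong₂ _xor_ (rank-cong A≗B c) (sign-cong (∖-cong A≗B c) w)

Code-cong : {A B : FinSet k} → A ≗ B → (w : List (Fin k)) (t : Bool) → Code A w t ≡ Code B w t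
Code-cong {A = A} {B} A≗B w t =
  cong₂ _∧_ (distinctIn-cong A≗B w)
    (trans (Final-cong (∖*-cong A≗B w) (t xor sign A w))
           (cong (λ s → Final (B ∖* w) (t xor s)) (sign-cong A≗B w)))

-- Codewords differ in at least two positions

parity : (Fin k → Bool) → List (Fin k) → Bool
parity p []      = false
parity p (c ∷ w) = p c xor parity p w

parity-xor : (p q : Fin k → Bool) (w : List (Fin k)) →
             parity p w xor parity q w ≡ parity (λ c → p c xor q c) w
parity-xor p q []      = refl
parity-xor p q (c ∷ w) =
  trans (interchange (p c) (parity p w) (q c) (parity q w)) (cong ((p c xor q c) xor_) (parity-xor p q w))
  where
  interchange : ∀ x y z u → (x xor y) xor (z xor u) ≡ (x xor z) xor (y xor u)
  interchange = solve 4 (λ x y z u → (x :+ y) :+ (z :+ u) := (x :+ z) :+ (y :+ u)) refl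

parity-cong-All : {p q : Fin k → Bool} {w : List (Fin k)} → All (λ c → p c ≡ q c) w → parity p w ≡ parity q w
parity-cong-All []         = refl
parity-cong-All (pc ∷ pcs) = cong₂ _xor_ pc (parity-cong-All pcs)

distinctIn⇒All : (A : FinSet k) (w : List (Fin k)) → distinctIn A w ≡ true → All (λ c → A c ≡ true) w
distinctIn⇒All A []      _ = []
distinctIn⇒All A (c ∷ w) h with A c in Ac
... | true = Ac ∷ All.map (∖-sub A) (distinctIn⇒All (A ∖ c) w h)

distinctIn-mono : (A B : FinSet k) → (∀ d → A d ≡ true → B d ≡ true) →
                  (w : List (Fin k)) → distinctIn A w ≡ true → distinctIn B w ≡ true
distinctIn-mono A B A⊆B []      _ = refl
distinctIn-mono A B A⊆B (c ∷ w) h with A c in Ac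
... | true rewrite A⊆B c Ac = distinctIn-mono (A ∖ c) (B ∖ c) ∖c-mono w h
  where
  ∖c-mono : ∀ d → (A ∖ c) d ≡ true → (B ∖ c) d ≡ true
  ∖c-mono d e = ∖-other B (A⊆B d (∖-sub A e)) (∖-≢ A e)

∖*-member : (A : FinSet k) {a : Fin k} → A a ≡ true →
            (w : List (Fin k)) → All (λ c → c ≢ a) w → (A ∖* w) a ≡ true
∖*-member A Aa []      []         = Aa
∖*-member A Aa (c ∷ w) (c≢a ∷ ws) = ∖*-member (A ∖ c) (∖-other A Aa (c≢a ∘ sym)) w ws

∖-∖* : (A : FinSet k) (a : Fin k) (w : List (Fin k)) → (A ∖ a) ∖* w ≗ (A ∖* w) ∖ a
∖-∖* A a []      = λ _ → refl
∖-∖* A a (c ∷ w) d = trans (∖*-cong (∖-comm A a c) w d) (∖-∖* (A ∖ c) a w d)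

rank-∖* : (A : FinSet k) (w : List (Fin k)) → distinctIn A w ≡ true →
          (c : Fin k) → rank A c ≡ rank (A ∖* w) c xor parity (λ d → ltᵇ d c) w
rank-∖* A []      _ c = sym (xor-identityʳ (rank A c))
rank-∖* A (d ∷ w) h c with A d in Ad
... | true = begin
  rank A c
    ≡⟨ rank-∖ A Ad c ⟩
  ltᵇ d c xor rank (A ∖ d) c
    ≡⟨ cong (ltᵇ d c xor_) (rank-∖* (A ∖ d) w h c) ⟩
  ltᵇ d c xor (rank (A ∖* (d ∷ w)) c xor parity (λ d → ltᵇ d c) w)
    ≡⟨ x∙yz≈y∙xz (ltᵇ d c) (rank (A ∖* (d ∷ w)) c) (parity (λ d → ltᵇ d c) w) ⟩
  rank (A ∖* (d ∷ w)) c xor (ltᵇ d c xor parity (λ d → ltᵇ d c) w) ∎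
  where
  open ≡-Reasoning
  x∙yz≈y∙xz : ∀ x y z → x xor (y xor z) ≡ y xor (x xor z)
  x∙yz≈y∙xz = solve 3 (λ x y z → x :+ (y :+ z) := y :+ (x :+ z)) refl

sign-∖ : (A : FinSet k) {a : Fin k} → A a ≡ true → (w : List (Fin k)) → All (λ c → c ≢ a) w →
         sign (A ∖ a) w ≡ sign A w xor parity (ltᵇ a) w
sign-∖ A Aa [] [] = refl
sign-∖ A {a} Aa (c ∷ w) (c≢a ∷ ws) = begin
  rank (A ∖ a) c xor sign ((A ∖ a) ∖ c) w
    ≡⟨ cong₂ _xor_ (rank-∖-xor A Aa c) (sign-cong (∖-comm A a c) w) ⟩
  (ltᵇ a c xor rank A c) xor sign ((A ∖ c) ∖ a) w
    ≡⟨ cong ((ltᵇ a c xor rank A c) xor_) (sign-∖ (A ∖ c) (∖-other A Aa (c≢a ∘ sym)) w ws) ⟩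
  (ltᵇ a c xor rank A c) xor (sign (A ∖ c) w xor parity (ltᵇ a) w)
    ≡⟨ regroup (ltᵇ a c) (rank A c) (sign (A ∖ c) w) (parity (ltᵇ a) w) ⟩
  (rank A c xor sign (A ∖ c) w) xor (ltᵇ a c xor parity (ltᵇ a) w) ∎
  where
  open ≡-Reasoning
  regroup : ∀ x r s p → (x xor r) xor (s xor p) ≡ (r xor s) xor (x xor p)
  regroup = solve 4 (λ x r s p → (x :+ r) :+ (s :+ p) := (r :+ s) :+ (x :+ p)) refl

sign-cons : (B : FinSet k) {a : Fin k} (post : List (Fin k)) →
            B a ≡ true → distinctIn (B ∖ a) post ≡ true →
            sign B (a ∷ post) ≡ rank (B ∖* post) a xor (sign B post xor parity (λ _ → true) post)
sign-cons B {a} post Ba h = begin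
  rank B a xor sign (B ∖ a) post
    ≡⟨ cong₂ _xor_ (rank-∖* B post (distinctIn-mono (B ∖ a) B (λ _ → ∖-sub B) post h) a)
                   (sign-∖ B Ba post a∉post) ⟩
  (rank (B ∖* post) a xor below) xor (sign B post xor above)
    ≡⟨ regroup (rank (B ∖* post) a) below (sign B post) above ⟩
  rank (B ∖* post) a xor (sign B post xor (below xor above))
    ≡⟨ cong (λ x → rank (B ∖* post) a xor (sign B post xor x)) below-xor-above ⟩
  rank (B ∖* post) a xor (sign B post xor parity (λ _ → true) post) ∎
  where
  open ≡-Reasoning
  below above : Bool
  below = parity (λ d → ltᵇ d a) post
  above = parity (ltᵇ a) post
  a∉post : All (λ c → c ≢ a) post
  a∉post = All.map (∖-≢ B) (distinctIn⇒All (B ∖ a) post h)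
  below-xor-above : below xor above ≡ parity (λ _ → true) post
  below-xor-above = trans (parity-xor _ _ post) (parity-cong-All (All.map one-smaller a∉post))
    where
    one-smaller : ∀ {d} → d ≢ a → ltᵇ d a xor ltᵇ a d ≡ true
    one-smaller {d} d≢a = trans (cong (ltᵇ d a xor_) (ltᵇ-flip d≢a)) (xor-inverseʳ (ltᵇ d a))
  regroup : ∀ r x s y → (r xor x) xor (s xor y) ≡ r xor (s xor (x xor y))
  regroup = solve 4 (λ r x s y → (r :+ x) :+ (s :+ y) := r :+ (s :+ (x :+ y))) refl

Final⇒ : (A : FinSet k) (t : Bool) → Final A t ≡ true → evens A ≡ 1 × odds A ≡ 1 × t ≡ closing A
Final⇒ A t h = ≡ᵇ-true (∧-conicalˡ _ _ h) , ≡ᵇ-true (∧-conicalˡ _ _ rest) , xor≡false (∧-conicalʳ _ _ rest)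
  where
  rest : ((odds A ≡ᵇ 1) ∧ not (t xor closing A)) ≡ true
  rest = ∧-conicalʳ (evens A ≡ᵇ 1) _ h
  ≡ᵇ-true : ∀ {m n} → (m ≡ᵇ n) ≡ true → m ≡ n
  ≡ᵇ-true {m} {n} e = ≡ᵇ⇒≡ m n (Equivalence.from T-≡ e)
  xor≡false : ∀ {x y} → not (x xor y) ≡ true → x ≡ y
  xor≡false {false} {false} _ = refl
  xor≡false {true}  {true}  _ = refl

module Pair {A : FinSet k} {y w : Fin k} (Ay : A y ≡ true) (Aw : (A ∖ y) w ≡ true)
            (empty : ∀ d → ((A ∖ y) ∖ w) d ≡ false) where

  rank-pair : (c : Fin k) → rank A c ≡ ltᵇ y c xor ltᵇ w c
  rank-pair c = ⨁-pair A (λ d → ltᵇ d c) Ay Aw empty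

  closing-pair : evens A ≡ 1 → closing A ≡ (not (evenᵇ w) ∧ ltᵇ w y) xor (evenᵇ w ∧ ltᵇ y w)
  closing-pair evens≡1 = begin
    closing A
      ≡⟨ ⨁-pair A (λ d → evenᵇ d ∧ rank A d) Ay Aw empty ⟩
    (evenᵇ y ∧ rank A y) xor (evenᵇ w ∧ rank A w)
      ≡⟨ cong₂ (λ r s → (evenᵇ y ∧ r) xor (evenᵇ w ∧ s)) rank-y rank-w ⟩
    (evenᵇ y ∧ ltᵇ w y) xor (evenᵇ w ∧ ltᵇ y w)
      ≡⟨ cong (λ e → (e ∧ ltᵇ w y) xor (evenᵇ w ∧ ltᵇ y w)) opposite-parity ⟩
    (not (evenᵇ w) ∧ ltᵇ w y) xor (evenᵇ w ∧ ltᵇ y w) ∎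
    where
    open ≡-Reasoning
    rank-y : rank A y ≡ ltᵇ w y
    rank-y = trans (rank-pair y) (cong (_xor ltᵇ w y) (ltᵇ-irrefl y))
    rank-w : rank A w ≡ ltᵇ y w
    rank-w = trans (rank-pair w) (trans (cong (ltᵇ y w xor_) (ltᵇ-irrefl w)) (xor-identityʳ (ltᵇ y w)))
    one-of : ∀ x z → 𝟙 x + 𝟙 z ≡ 1 → x ≡ not z
    one-of true  false _ = refl
    one-of false true  _ = refl
    opposite-parity : evenᵇ y ≡ not (evenᵇ w)
    opposite-parity = one-of (evenᵇ y) (evenᵇ w) (trans (sym (∑-pair A (λ d → 𝟙 (evenᵇ d)) Ay Aw empty)) evens≡1)

Final-∖⇒ : (R : FinSet k) {x y w : Fin k} (u : Bool) →
           R x ≡ true → (R ∖ x) y ≡ true → ((R ∖ x) ∖ y) w ≡ true →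
           (∀ d → (((R ∖ x) ∖ y) ∖ w) d ≡ false) →
           Final (R ∖ x) (u xor rank R x) ≡ true →
           u ≡ (ltᵇ y x xor ltᵇ w x) xor ((not (evenᵇ w) ∧ ltᵇ w y) xor (evenᵇ w ∧ ltᵇ y w))
Final-∖⇒ R {x} {y} {w} u Rx Ry Rw empty F = begin
  u
    ≡⟨ xor-isolateˡ closing≡ ⟩
  rank R x xor closing (R ∖ x)
    ≡⟨ cong₂ _xor_ rank≡ (closing-pair evens≡1) ⟩
  (ltᵇ y x xor ltᵇ w x) xor ((not (evenᵇ w) ∧ ltᵇ w y) xor (evenᵇ w ∧ ltᵇ y w)) ∎
  where
  open ≡-Reasoning
  open Pair Ry Rw empty
  evens≡1 : evens (R ∖ x) ≡ 1
  evens≡1 = proj₁ (Final⇒ (R ∖ x) (u xor rank R x) F)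
  closing≡ : u xor rank R x ≡ closing (R ∖ x)
  closing≡ = proj₂ (proj₂ (Final⇒ (R ∖ x) (u xor rank R x) F))
  rank≡ : rank R x ≡ ltᵇ y x xor ltᵇ w x
  rank≡ = trans (rank-∖ R Rx x) (trans (cong (_xor rank (R ∖ x) x) (ltᵇ-irrefl x)) (rank-pair x))

-- The arrangements a, then R ∖ a, and b, then R ∖ b, (each tail ordered even colour first)
-- differ by the transposition of a and b, so they cannot have the same sign.
Final-transposition : (R : FinSet k) {a b : Fin k} (u : Bool) → R a ≡ true → R b ≡ true → a ≢ b →
                      Final (R ∖ a) (u xor rank R a) ≡ true → Final (R ∖ b) (u xor rank R b) ≡ true → ⊥
Final-transposition {k} R {a} {b} u Ra Rb a≢b Fa Fb =
  true≢false (trans (sym (transposition e p q r)) (trans (cong₂ _xor_ (sym ua) (sym ub)) (xor-same u)))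
  where
  Rab : (R ∖ a) b ≡ true
  Rab = ∖-other R Rb (a≢b ∘ sym)
  size-Ra : size (R ∖ a) ≡ 2
  size-Ra with Final⇒ (R ∖ a) (u xor rank R a) Fa
  ... | e , o , _ = trans (size≡evens+odds (R ∖ a)) (cong₂ _+_ e o)
  size-Rab : size ((R ∖ a) ∖ b) ≡ 1
  size-Rab = suc-injective (trans (sym (size-∖ (R ∖ a) Rab)) size-Ra)
  w : Fin k
  w = proj₁ (size≡suc⇒member ((R ∖ a) ∖ b) size-Rab)
  Rabw : ((R ∖ a) ∖ b) w ≡ true
  Rabw = proj₂ (size≡suc⇒member ((R ∖ a) ∖ b) size-Rab)
  empty : ∀ d → (((R ∖ a) ∖ b) ∖ w) d ≡ false
  empty = size≡0⇒empty (((R ∖ a) ∖ b) ∖ w)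
                       (suc-injective (trans (sym (size-∖ ((R ∖ a) ∖ b) Rabw)) size-Rab))
  w≢a : w ≢ a
  w≢a = ∖-≢ R (∖-sub (R ∖ a) Rabw)
  w≢b : w ≢ b
  w≢b = ∖-≢ (R ∖ a) Rabw
  e p q r : Bool
  e = evenᵇ w
  p = ltᵇ a b
  q = ltᵇ a w
  r = ltᵇ b w
  ua : u ≡ (not p xor not q) xor ((not e ∧ not r) xor (e ∧ r))
  ua = trans (Final-∖⇒ R u Ra Rab Rabw empty Fa)
             (cong₂ (λ s v → s xor ((not e ∧ v) xor (e ∧ r)))
                    (cong₂ _xor_ (ltᵇ-flip a≢b) (ltᵇ-flip (w≢a ∘ sym))) (ltᵇ-flip (w≢b ∘ sym)))
  ub : u ≡ (p xor not r) xor ((not e ∧ not q) xor (e ∧ q))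
  ub = trans (Final-∖⇒ R u Rb (∖-other R Ra a≢b) (trans (∖-comm R b a w) Rabw)
                         (λ d → trans (∖-cong (∖-comm R b a) w d) (empty d)) Fb)
             (cong₂ (λ s v → s xor ((not e ∧ v) xor (e ∧ q)))
                    (cong (p xor_) (ltᵇ-flip (w≢b ∘ sym))) (ltᵇ-flip (w≢a ∘ sym)))
  transposition : ∀ e p q r → ((not p xor not q) xor ((not e ∧ not r) xor (e ∧ r))) xor
                              ((p xor not r) xor ((not e ∧ not q) xor (e ∧ q))) ≡ true
  transposition = solve 4 (λ e p q r →
    (((con true :+ p) :+ (con true :+ q)) :+ (((con true :+ e) :* (con true :+ r)) :+ (e :* r))) :+
    ((p :+ (con true :+ r)) :+ (((con true :+ e) :* (con true :+ q)) :+ (e :* q))) := con true) refl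
  true≢false : true ≡ false → ⊥
  true≢false ()

Code-++ : (A : FinSet k) (pre w : List (Fin k)) (t : Bool) →
          Code A (pre ++ w) t ≡ distinctIn A pre ∧ Code (A ∖* pre) w (t xor sign A pre)
Code-++ A []        w t = cong (Code A w) (sym (xor-identityʳ t))
Code-++ A (c ∷ pre) w t = begin
  Code A (c ∷ pre ++ w) t
    ≡⟨ Code-∷ A c (pre ++ w) t ⟩
  A c ∧ Code (A ∖ c) (pre ++ w) (t xor rank A c)
    ≡⟨ cong (A c ∧_) (Code-++ (A ∖ c) pre w (t xor rank A c)) ⟩
  A c ∧ (distinctIn (A ∖ c) pre ∧ Code (A ∖* (c ∷ pre)) w ((t xor rank A c) xor sign (A ∖ c) pre))
    ≡⟨ sym (∧-assoc (A c) _ _) ⟩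
  (A c ∧ distinctIn (A ∖ c) pre) ∧ Code (A ∖* (c ∷ pre)) w ((t xor rank A c) xor sign (A ∖ c) pre)
    ≡⟨ cong (λ s → (A c ∧ distinctIn (A ∖ c) pre) ∧ Code (A ∖* (c ∷ pre)) w s) (xor-assoc t (rank A c) _) ⟩
  distinctIn A (c ∷ pre) ∧ Code (A ∖* (c ∷ pre)) w (t xor sign A (c ∷ pre)) ∎
  where open ≡-Reasoning

Code-∷⇒Final : (B : FinSet k) {a : Fin k} (post : List (Fin k)) (t : Bool) →
               let u = t xor (sign B post xor parity (λ _ → true) post) in
               Code B (a ∷ post) t ≡ true →
               (B ∖* post) a ≡ true × Final ((B ∖* post) ∖ a) (u xor rank (B ∖* post) a) ≡ true
Code-∷⇒Final B {a} post t h =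
  ∖*-member B Ba post (All.map (∖-≢ B) (distinctIn⇒All (B ∖ a) post distinct-post)) ,
  trans (cong (Final ((B ∖* post) ∖ a)) sign≡)
        (trans (Final-cong (λ d → sym (∖-∖* B a post d)) (t xor sign B (a ∷ post)))
               (∧-conicalʳ (distinctIn B (a ∷ post)) _ h))
  where
  v = sign B post xor parity (λ _ → true) post
  distinct : distinctIn B (a ∷ post) ≡ true
  distinct = ∧-conicalˡ _ (Final ((B ∖ a) ∖* post) (t xor sign B (a ∷ post))) h
  Ba : B a ≡ true
  Ba = ∧-conicalˡ (B a) (distinctIn (B ∖ a) post) distinct
  distinct-post : distinctIn (B ∖ a) post ≡ true
  distinct-post = ∧-conicalʳ (B a) (distinctIn (B ∖ a) post) distinct
  sign≡ : (t xor v) xor rank (B ∖* post) a ≡ t xor sign B (a ∷ post)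
  sign≡ = trans (solve 3 (λ t v r → (t :+ v) :+ r := t :+ (r :+ v)) refl t v (rank (B ∖* post) a))
                (cong (t xor_) (sym (sign-cons B post Ba distinct-post)))

Code-separated : (A : FinSet k) (pre : List (Fin k)) {a b : Fin k} (post : List (Fin k)) (t : Bool) →
                 Code A (pre ++ a ∷ post) t ≡ true → Code A (pre ++ b ∷ post) t ≡ true → a ≡ b
Code-separated A pre {a} {b} post t ha hb with a ≟ b
... | yes a≡b = a≡b
... | no  a≢b = ⊥-elim (Final-transposition (B ∖* post) u (proj₁ Fa) (proj₁ Fb) a≢b (proj₂ Fa) (proj₂ Fb))
  where
  B = A ∖* pre
  t′ = t xor sign A pre
  u = t′ xor (sign B post xor parity (λ _ → true) post)
  drop-pre : ∀ {c} → Code A (pre ++ c ∷ post) t ≡ true → Code B (c ∷ post) t′ ≡ true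
  drop-pre {c} h = ∧-conicalʳ (distinctIn A pre) _ (trans (sym (Code-++ A pre (c ∷ post) t)) h)
  Fa = Code-∷⇒Final B post t′ (drop-pre ha)
  Fb = Code-∷⇒Final B post t′ (drop-pre hb)

-- Counting codewords

count : {X : Set} → (X → Bool) → List X → ℕ
count p []       = 0
count p (x ∷ xs) = 𝟙 (p x) + count p xs

count-cong : {X : Set} {p q : X → Bool} → p ≗ q → (xs : List X) → count p xs ≡ count q xs
count-cong p≗q []       = refl
count-cong p≗q (x ∷ xs) = cong₂ _+_ (cong 𝟙 (p≗q x)) (count-cong p≗q xs)

count-++ : {X : Set} (p : X → Bool) (xs ys : List X) → count p (xs ++ ys) ≡ count p xs + count p ys
count-++ p []       ys = refl
count-++ p (x ∷ xs) ys = trans (cong (𝟙 (p x) +_) (count-++ p xs ys)) (sym (+-assoc (𝟙 (p x)) _ _))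

count-map : {X Y : Set} (p : Y → Bool) (f : X → Y) (xs : List X) → count p (map f xs) ≡ count (p ∘ f) xs
count-map p f []       = refl
count-map p f (x ∷ xs) = cong (𝟙 (p (f x)) +_) (count-map p f xs)

count-∧ : {X : Set} (b : Bool) (p : X → Bool) (xs : List X) →
          count (λ x → b ∧ p x) xs ≡ (if b then count p xs else 0)
count-∧ true  p xs       = refl
count-∧ false p []       = refl
count-∧ false p (x ∷ xs) = count-∧ false p xs

count-filter : {X : Set} {P : X → Set} (P? : Decidable P) (p : X → Bool) (xs : List X) →
               count p (filter P? xs) ≡ count (λ x → does (P? x) ∧ p x) xs
count-filter P? p []       = refl
count-filter P? p (x ∷ xs) with does (P? x)
... | true  = cong (𝟙 (p x) +_) (count-filter P? p xs)
... | false = count-filter P? p xs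

length-filter : {X : Set} {P : X → Set} (P? : Decidable P) (xs : List X) →
                length (filter P? xs) ≡ count (does ∘ P?) xs
length-filter P? xs =
  trans (sym (count-true (filter P? xs)))
        (trans (count-filter P? (λ _ → true) xs) (count-cong (λ x → ∧-identityʳ (does (P? x))) xs))
  where
  count-true : ∀ ys → count (λ _ → true) ys ≡ length ys
  count-true []       = refl
  count-true (_ ∷ ys) = cong suc (count-true ys)

count-words-suc : {k : ℕ} (r : ℕ) (p : List (Fin k) → Bool) →
                  count p (words k (suc r)) ≡ ∑[ full ] (λ c → count (p ∘ (c ∷_)) (words k r))
count-words-suc {k} r p = count-concatMap-tabulate (λ c → c)
  where
  count-concatMap-tabulate : ∀ {m} (g : Fin m → Fin k) →
    count p (concatMap (λ c → map (c ∷_) (words k r)) (tabulate g)) ≡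
    ∑[ full ] (λ i → count (p ∘ (g i ∷_)) (words k r))
  count-concatMap-tabulate {zero}  g = refl
  count-concatMap-tabulate {suc m} g =
    trans (count-++ p (map (g zero ∷_) (words k r)) _)
          (cong₂ _+_ (count-map p (g zero ∷_) (words k r)) (count-concatMap-tabulate (g ∘ suc)))

count-words-cong : {k : ℕ} (r : ℕ) {p q : List (Fin k) → Bool} → (∀ w → length w ≡ r → p w ≡ q w) →
                   count p (words k r) ≡ count q (words k r)
count-words-cong zero    p≡q = cong (_+ 0) (cong 𝟙 (p≡q [] refl))
count-words-cong (suc r) {p} {q} p≡q =
  trans (count-words-suc r p)
        (trans (∑-cong-∈ full (λ c _ → count-words-cong r (λ w len → p≡q (c ∷ w) (cong suc len))))
               (sym (count-words-suc r q)))

count-words-∧ : {k : ℕ} (r : ℕ) (A : FinSet k) (p : List (Fin k) → Bool) (q : Fin k → List (Fin k) → Bool) →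
                (∀ c w → p (c ∷ w) ≡ A c ∧ q c w) →
                count p (words k (suc r)) ≡ ∑[ A ] (λ c → count (q c) (words k r))
count-words-∧ {k} r A p q split =
  trans (count-words-suc r p)
        (∑-cong-∈ full (λ c _ → trans (count-cong (split c) (words k r)) (count-∧ (A c) (q c) (words k r))))

#arrangements : FinSet k → ℕ → ℕ
#arrangements {k} A r = count (distinctIn A) (words k r)

#arrangements-count : (A : FinSet k) (r m : ℕ) → size A ≡ r + m → #arrangements A r * m ! ≡ (r + m) !
#arrangements-count A zero    m _      = +-identityʳ (m !)
#arrangements-count {k} A (suc r) m size≡ = begin
  #arrangements A (suc r) * m !
    ≡⟨ cong (_* m !) (count-words-∧ r A (distinctIn A) (λ c → distinctIn (A ∖ c)) (λ _ _ → refl)) ⟩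
  ∑[ A ] (λ c → #arrangements (A ∖ c) r) * m !
    ≡⟨ sym (∑-*ʳ A (λ c → #arrangements (A ∖ c) r) (m !)) ⟩
  ∑[ A ] (λ c → #arrangements (A ∖ c) r * m !)
    ≡⟨ ∑-cong-∈ A (λ c Ac → #arrangements-count (A ∖ c) r m (suc-injective (trans (sym (size-∖ A Ac)) size≡)))
     ⟩
  ∑[ A ] (λ _ → (r + m) !)
    ≡⟨ ∑-const A ((r + m) !) ⟩
  size A * (r + m) !
    ≡⟨ cong (_* (r + m) !) size≡ ⟩
  (suc r + m) ! ∎
  where open ≡-Reasoning

#codes : FinSet k → ℕ → Bool → ℕ
#codes {k} A r t = count (λ w → Code A w t) (words k r)

#codes-suc : (A : FinSet k) (r : ℕ) (t : Bool) →
             #codes A (suc r) t ≡ ∑[ A ] (λ c → #codes (A ∖ c) r (t xor rank A c))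
#codes-suc A r t =
  count-words-∧ r A (λ w → Code A w t) (λ c w → Code (A ∖ c) w (t xor rank A c)) (λ c w → Code-∷ A c w t)

#codes-cong : {A B : FinSet k} → A ≗ B → (r : ℕ) (t : Bool) → #codes A r t ≡ #codes B r t
#codes-cong {k} A≗B r t = count-cong (λ w → Code-cong A≗B w t) (words k r)

Final-false+true : (A : FinSet k) → evens A + odds A ≡ 2 → 𝟙 (Final A false) + 𝟙 (Final A true) ≡ evens A * odds A
Final-false+true A = both (evens A) (odds A) (closing A)
  where
  both : ∀ e o g → e + o ≡ 2 →
         𝟙 ((e ≡ᵇ 1) ∧ ((o ≡ᵇ 1) ∧ not g)) + 𝟙 ((e ≡ᵇ 1) ∧ ((o ≡ᵇ 1) ∧ not (not g))) ≡ e * o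
  both 0 _ g     refl = refl
  both 1 _ false refl = refl
  both 1 _ true  refl = refl
  both 2 _ g     refl = refl
  both (suc (suc (suc _))) _ g ()

removal-product : (A : FinSet k) {c : Fin k} → A c ≡ true →
                  evens (A ∖ c) * odds (A ∖ c) + (𝟙 (evenᵇ c) * odds A + 𝟙 (not (evenᵇ c)) * evens A) ≡
                  evens A * odds A
removal-product A {c} Ac =
  expand (evenᵇ c) (evens (A ∖ c)) (odds (A ∖ c))
         (∑-remove A (λ d → 𝟙 (evenᵇ d)) Ac) (∑-remove A (λ d → 𝟙 (not (evenᵇ d))) Ac)
  where
  expand : ∀ e E′ O′ {E O} → E ≡ 𝟙 e + E′ → O ≡ 𝟙 (not e) + O′ →
           E′ * O′ + (𝟙 e * O + 𝟙 (not e) * E) ≡ E * O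
  expand true  E′ O′ refl refl = even-case E′ O′
    where
    even-case : ∀ x y → x * y + (1 * (0 + y) + 0 * (1 + x)) ≡ (1 + x) * (0 + y)
    even-case = solve-∀
  expand false E′ O′ refl refl = odd-case E′ O′
    where
    odd-case : ∀ x y → x * y + (0 * (1 + y) + 1 * (0 + x)) ≡ (0 + x) * (1 + y)
    odd-case = solve-∀

∑-removal-product : (A : FinSet k) →
                    ∑[ A ] (λ c → evens (A ∖ c) * odds (A ∖ c)) + 2 * (evens A * odds A) ≡
                    size A * (evens A * odds A)
∑-removal-product A = begin
  S + 2 * (E * O)
    ≡⟨ cong (S +_) (arrange E O) ⟩
  S + (evens A * O + odds A * E)
    ≡⟨ cong (S +_) (sym (cong₂ _+_ (∑-*ʳ A _ O) (∑-*ʳ A _ E))) ⟩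
  S + (∑[ A ] (λ c → 𝟙 (evenᵇ c) * O) + ∑[ A ] (λ c → 𝟙 (not (evenᵇ c)) * E))
    ≡⟨ cong (S +_) (sym (∑-+ A _ _)) ⟩
  S + ∑[ A ] (λ c → 𝟙 (evenᵇ c) * O + 𝟙 (not (evenᵇ c)) * E)
    ≡⟨ sym (∑-+ A _ _) ⟩
  ∑[ A ] (λ c → evens (A ∖ c) * odds (A ∖ c) + (𝟙 (evenᵇ c) * O + 𝟙 (not (evenᵇ c)) * E))
    ≡⟨ ∑-cong-∈ A (λ c Ac → removal-product A Ac) ⟩
  ∑[ A ] (λ _ → E * O)
    ≡⟨ ∑-const A (E * O) ⟩
  size A * (E * O) ∎
  where
  open ≡-Reasoning
  S E O : ℕ
  S = ∑[ A ] (λ c → evens (A ∖ c) * odds (A ∖ c))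
  E = evens A
  O = odds A
  arrange : ∀ e o → 2 * (e * o) ≡ e * o + o * e
  arrange = solve-∀

#codes-total : (A : FinSet k) (r : ℕ) → size A ≡ 2 + r →
               #codes A r false + #codes A r true ≡ evens A * odds A * r !
#codes-total A zero size≡ =
  trans (cong₂ _+_ (+-identityʳ (𝟙 (Final A false))) (+-identityʳ (𝟙 (Final A true))))
        (trans (Final-false+true A (trans (sym (size≡evens+odds A)) size≡))
               (sym (*-identityʳ (evens A * odds A))))
#codes-total A (suc r) size≡ = begin
  #codes A (suc r) false + #codes A (suc r) true
    ≡⟨ cong₂ _+_ (#codes-suc A r false) (#codes-suc A r true) ⟩
  ∑[ A ] (λ c → #codes (A ∖ c) r (rank A c)) + ∑[ A ] (λ c → #codes (A ∖ c) r (not (rank A c)))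
    ≡⟨ sym (∑-+ A _ _) ⟩
  ∑[ A ] (λ c → #codes (A ∖ c) r (rank A c) + #codes (A ∖ c) r (not (rank A c)))
    ≡⟨ ∑-cong-∈ A (λ c Ac → trans (both-signs (A ∖ c) (rank A c)) (#codes-total (A ∖ c) r (size-∖′ Ac))) ⟩
  ∑[ A ] (λ c → evens (A ∖ c) * odds (A ∖ c) * r !)
    ≡⟨ ∑-*ʳ A _ (r !) ⟩
  S * r !
    ≡⟨ cong (_* r !) S≡ ⟩
  suc r * (evens A * odds A) * r !
    ≡⟨ arrange (evens A * odds A) r (r !) ⟩
  evens A * odds A * (suc r * r !) ∎
  where
  open ≡-Reasoning
  S : ℕ
  S = ∑[ A ] (λ c → evens (A ∖ c) * odds (A ∖ c))
  size-∖′ : ∀ {c} → A c ≡ true → size (A ∖ c) ≡ 2 + r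
  size-∖′ Ac = suc-injective (trans (sym (size-∖ A Ac)) size≡)
  both-signs : ∀ B x → #codes B r x + #codes B r (not x) ≡ #codes B r false + #codes B r true
  both-signs B false = refl
  both-signs B true  = +-comm (#codes B r true) (#codes B r false)
  S≡ : S ≡ suc r * (evens A * odds A)
  S≡ = +-cancelʳ-≡ (2 * (evens A * odds A)) S (suc r * (evens A * odds A))
         (trans (∑-removal-product A)
                (trans (cong (_* (evens A * odds A)) size≡) (three+r (evens A * odds A) r)))
    where
    three+r : ∀ x r → (3 + r) * x ≡ (1 + r) * x + 2 * x
    three+r = solve-∀
  arrange : ∀ x r f → (1 + r) * x * f ≡ x * ((1 + r) * f)
  arrange = solve-∀

-- Exchanging the first two letters of a word flips its sign.
#codes-flip : (A : FinSet k) (r : ℕ) (t : Bool) → #codes A (2 + r) t ≡ #codes A (2 + r) (not t)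
#codes-flip A r t = begin
  #codes A (2 + r) t
    ≡⟨ expand t ⟩
  ∑[ A ] (λ c → ∑[ A ∖ c ] (λ d → F t c d))
    ≡⟨ ∑-comm-pairs A (F t) ⟩
  ∑[ A ] (λ d → ∑[ A ∖ d ] (λ c → F t c d))
    ≡⟨ ∑-cong-∈ A (λ d Ad → ∑-cong-∈ (A ∖ d) (λ c Adc → swap Ad Adc)) ⟩
  ∑[ A ] (λ d → ∑[ A ∖ d ] (λ c → F (not t) d c))
    ≡⟨ sym (expand (not t)) ⟩
  #codes A (2 + r) (not t) ∎
  where
  open ≡-Reasoning
  F : Bool → Fin _ → Fin _ → ℕ
  F t c d = #codes ((A ∖ c) ∖ d) r ((t xor rank A c) xor rank (A ∖ c) d)
  expand : ∀ t → #codes A (2 + r) t ≡ ∑[ A ] (λ c → ∑[ A ∖ c ] (λ d → F t c d))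
  expand t = trans (#codes-suc A (suc r) t) (∑-cong-∈ A (λ c _ → #codes-suc (A ∖ c) r (t xor rank A c)))
  swap : ∀ {c d} → A d ≡ true → (A ∖ d) c ≡ true → F t c d ≡ F (not t) d c
  swap {c} {d} Ad Adc =
    trans (#codes-cong (∖-comm A c d) r ((t xor rank A c) xor rank (A ∖ c) d)) (cong (#codes ((A ∖ d) ∖ c) r) sign≡)
    where
    c≢d = ∖-≢ A Adc
    x = ltᵇ c d
    sign≡ : (t xor rank A c) xor rank (A ∖ c) d ≡ (not t xor rank A d) xor rank (A ∖ d) c
    sign≡ = begin
      (t xor rank A c) xor rank (A ∖ c) d
        ≡⟨ cong ((t xor rank A c) xor_) (rank-∖-xor A (∖-sub A Adc) d) ⟩
      (t xor rank A c) xor (x xor rank A d)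
        ≡⟨ transpose t (rank A c) x (rank A d) ⟩
      (not t xor rank A d) xor (not x xor rank A c)
        ≡⟨ cong (λ y → (not t xor rank A d) xor (y xor rank A c)) (sym (ltᵇ-flip c≢d)) ⟩
      (not t xor rank A d) xor (ltᵇ d c xor rank A c)
        ≡⟨ cong ((not t xor rank A d) xor_) (sym (rank-∖-xor A Ad c)) ⟩
      (not t xor rank A d) xor rank (A ∖ d) c ∎
      where
      transpose : ∀ t a x b → (t xor a) xor (x xor b) ≡ (not t xor b) xor (not x xor a)
      transpose = solve 4 (λ t a x b → (t :+ a) :+ (x :+ b) :=
                                         ((con true :+ t) :+ b) :+ ((con true :+ x) :+ a)) refl

-- The strategy

wins-last : {c : ℕ} (s : Strategy c) (heard xs : List (Fin c)) {a : Fin c} →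
            wins s heard (xs ++ [ a ]) ≡ true → s (heard ++ xs) [] ≡ a
wins-last s heard [] {a} h =
  trans (cong (λ h → s h []) (++-identityʳ heard)) (eqᵇ⇒≡ (∧-conicalˡ (eqᵇ (s heard []) a) true h))
wins-last s heard (x ∷ xs) {a} h =
  trans (cong (λ h → s h []) (sym (++-assoc heard [ x ] xs))) (wins-last s (heard ++ [ x ]) xs rest)
  where
  g = s heard (xs ++ [ a ])
  rest : wins s (heard ++ [ x ]) (xs ++ [ a ]) ≡ true
  rest = subst (λ y → wins s (heard ++ [ y ]) (xs ++ [ a ]) ≡ true)
               (eqᵇ⇒≡ (∧-conicalˡ (eqᵇ g x) _ h)) (∧-conicalʳ (eqᵇ g x) _ h)

-- Guess the colour that completes a codeword; failing that, repeat the first colour heard,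
-- a guess that is wrong on injective assignments.
module Greedy {c : ℕ} (C : List (Fin c) → Bool) (default : Fin c)
              (separated : ∀ pre {a b} post → C (pre ++ a ∷ post) ≡ true → C (pre ++ b ∷ post) ≡ true → a ≡ b)
              where

  greedy : Strategy c
  greedy heard seen with any? (λ g → C (heard ++ g ∷ seen) Data.Bool.≟ true)
  ... | yes (g , _) = g
  ... | no  _       = fromMaybe default (head heard)

  greedy-completes : (heard : List (Fin c)) {a : Fin c} (seen : List (Fin c)) →
                     C (heard ++ a ∷ seen) ≡ true → greedy heard seen ≡ a
  greedy-completes heard {a} seen h with any? (λ g → C (heard ++ g ∷ seen) Data.Bool.≟ true)
  ... | yes (g , hg) = separated heard seen hg h
  ... | no  none     = ⊥-elim (none (a , h))

  greedy-last : (heard : List (Fin c)) {a : Fin c} → greedy heard [] ≡ a →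
                C (heard ++ [ a ]) ≡ true ⊎
                (fromMaybe default (head heard) ≡ a × ∀ g → C (heard ++ [ g ]) ≢ true)
  greedy-last heard eq with any? (λ g → C (heard ++ [ g ]) Data.Bool.≟ true)
  ... | yes (g , hg) = inj₁ (subst (λ a → C (heard ++ [ a ]) ≡ true) eq hg)
  ... | no  none     = inj₂ (eq , λ g hg → none (g , hg))

  wins-codewords : (heard xs : List (Fin c)) → C (heard ++ xs) ≡ true → wins greedy heard xs ≡ true
  wins-codewords heard []       _ = refl
  wins-codewords heard (x ∷ xs) h rewrite greedy-completes heard xs h =
    cong₂ _∧_ (eqᵇ-refl x) (wins-codewords (heard ++ [ x ]) xs (trans (cong C (++-assoc heard [ x ] xs)) h))

distinct : List (Fin k) → Bool
distinct xs = does (allPairs? (λ a b → ¬? (a ≟ b)) xs)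

all-∧ : (p q : Fin k → Bool) (w : List (Fin k)) → all (λ d → p d ∧ q d) w ≡ all p w ∧ all q w
all-∧ p q []      = refl
all-∧ p q (c ∷ w) = trans (cong ((p c ∧ q c) ∧_) (all-∧ p q w)) (interchange (p c) (q c) (all p w) (all q w))
  where
  interchange : ∀ x y z u → (x ∧ y) ∧ (z ∧ u) ≡ (x ∧ z) ∧ (y ∧ u)
  interchange = solve 4 (λ x y z u → (x :* y) :* (z :* u) := (x :* z) :* (y :* u)) refl

distinctIn≡all∧distinct : (A : FinSet k) (w : List (Fin k)) → distinctIn A w ≡ all A w ∧ distinct w
distinctIn≡all∧distinct A []      = refl
distinctIn≡all∧distinct A (c ∷ w) = begin
  A c ∧ distinctIn (A ∖ c) w
    ≡⟨ cong (A c ∧_) (distinctIn≡all∧distinct (A ∖ c) w) ⟩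
  A c ∧ (all (A ∖ c) w ∧ distinct w)
    ≡⟨ cong (λ x → A c ∧ (x ∧ distinct w)) (all-∧ A (λ d → not (eqᵇ d c)) w) ⟩
  A c ∧ ((all A w ∧ all (λ d → not (eqᵇ d c)) w) ∧ distinct w)
    ≡⟨ cong (λ x → A c ∧ ((all A w ∧ x) ∧ distinct w)) (all-cong w) ⟩
  A c ∧ ((all A w ∧ fresh) ∧ distinct w)
    ≡⟨ regroup (A c) (all A w) fresh (distinct w) ⟩
  (A c ∧ all A w) ∧ (fresh ∧ distinct w) ∎
  where
  open ≡-Reasoning
  fresh = does (All.all? (λ b → ¬? (c ≟ b)) w)
  all-cong : ∀ w → all (λ d → not (eqᵇ d c)) w ≡ does (All.all? (λ b → ¬? (c ≟ b)) w)
  all-cong []      = refl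
  all-cong (d ∷ w) = cong₂ _∧_ (cong not (eqᵇ-sym d c)) (all-cong w)
  regroup : ∀ x y z u → x ∧ ((y ∧ z) ∧ u) ≡ (x ∧ y) ∧ (z ∧ u)
  regroup = solve 4 (λ x y z u → x :* ((y :* z) :* u) := (x :* y) :* (z :* u)) refl

distinctIn-full : (w : List (Fin k)) → distinctIn full w ≡ distinct w
distinctIn-full w = trans (distinctIn≡all∧distinct full w) (cong (_∧ distinct w) (all-true w))
  where
  all-true : ∀ w → all full w ≡ true
  all-true []      = refl
  all-true (_ ∷ w) = all-true w

repeated-not-distinct : (a : Fin k) (ys : List (Fin k)) → distinct (a ∷ ys ++ [ a ]) ≡ false
repeated-not-distinct a ys = cong (_∧ distinct (ys ++ [ a ])) (stale ys)
  where
  stale : ∀ ys → does (All.all? (λ b → ¬? (a ≟ b)) (ys ++ [ a ])) ≡ false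
  stale []       = cong (λ b → not b ∧ true) (eqᵇ-refl a)
  stale (y ∷ ys) = trans (cong (not (eqᵇ a y) ∧_) (stale ys)) (∧-zeroʳ (not (eqᵇ a y)))

IsCode : (n : ℕ) → List (Fin (n + 2)) → Bool
IsCode n w = Code full w false

module CodeStrategy (n : ℕ) = Greedy (IsCode n) (n ↑ʳ zero) (λ pre post → Code-separated full pre post false)

strategy : (n : ℕ) → Strategy (n + 2)
strategy = CodeStrategy.greedy

-- With a single prisoner the fallback is never used, as the word [ 2 ] is a codeword.
fallback-fails : (n : ℕ) (xs : List (Fin (n + 2))) {a : Fin (n + 2)} → length (xs ++ [ a ]) ≡ n →
                 distinct (xs ++ [ a ]) ≡ true → fromMaybe (n ↑ʳ zero) (head xs) ≡ a →
                 (∀ g → IsCode n (xs ++ [ g ]) ≢ true) → ⊥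
fallback-fails .1 []       refl _    _    none = none (suc (suc zero)) refl
fallback-fails n  (h ∷ ys) _    dist refl _    with () ← trans (sym dist) (repeated-not-distinct h ys)

wins⇒IsCode : (n : ℕ) (xs : List (Fin (n + 2))) {a : Fin (n + 2)} → length (xs ++ [ a ]) ≡ n →
              distinct (xs ++ [ a ]) ≡ true → wins (strategy n) [] (xs ++ [ a ]) ≡ true →
              IsCode n (xs ++ [ a ]) ≡ true
wins⇒IsCode n xs len dist won with CodeStrategy.greedy-last n xs (wins-last (strategy n) [] xs won)
... | inj₁ is-code              = is-code
... | inj₂ (fallback≡a , none) = ⊥-elim (fallback-fails n xs len dist fallback≡a none)

wins≡IsCode : (n : ℕ) → 1 ≤ n → (x : List (Fin (n + 2))) → length x ≡ n →
              distinct x ∧ wins (strategy n) [] x ≡ IsCode n x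
wins≡IsCode n 1≤n x len = ⇔→≡ {z = true} (mk⇔ (winner⇒code x len) code⇒winner)
  where
  code⇒winner : IsCode n x ≡ true → distinct x ∧ wins (strategy n) [] x ≡ true
  code⇒winner code =
    cong₂ _∧_ (trans (sym (distinctIn-full x)) (∧-conicalˡ _ _ code)) (CodeStrategy.wins-codewords n [] x code)
  winner⇒code : ∀ x → length x ≡ n → distinct x ∧ wins (strategy n) [] x ≡ true → IsCode n x ≡ true
  winner⇒code x len h with initLast x
  ... | []       with () ← subst (1 ≤_) (sym len) 1≤n
  ... | xs ∷ʳ′ a = wins⇒IsCode n xs len (∧-conicalˡ _ _ h) (∧-conicalʳ (distinct (xs ++ [ a ])) _ h)

-- The success probability

size-full : (m : ℕ) → size (full {m}) ≡ m
size-full zero    = refl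
size-full (suc m) = cong suc (size-full m)

evens-full : (m : ℕ) → evens (full {m}) ≡ ⌈ m /2⌉
odds-full  : (m : ℕ) → odds (full {m}) ≡ ⌊ m /2⌋
evens-full zero    = refl
evens-full (suc m) = cong suc (odds-full m)
odds-full zero    = refl
odds-full (suc m) = trans (∑-cong-∈ (full {m}) (λ d _ → cong 𝟙 (not-involutive (evenᵇ d)))) (evens-full m)

winCount≡#codes : (n : ℕ) → 1 ≤ n → winCount n 2 (strategy n) ≡ #codes full n false
winCount≡#codes n 1≤n =
  trans (length-filter (λ x → T? (wins (strategy n) [] x)) (assignments n 2))
        (trans (count-filter (λ x → allPairs? (λ a b → ¬? (a ≟ b)) x) (λ x → wins (strategy n) [] x)
                             (words (n + 2) n))
               (count-words-cong n (wins≡IsCode n 1≤n)))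

#assignments : (n : ℕ) → length (assignments n 2) ≡ #arrangements full n
#assignments n = trans (length-filter (λ x → allPairs? (λ a b → ¬? (a ≟ b)) x) (words (n + 2) n))
                       (count-cong (λ x → sym (distinctIn-full x)) (words (n + 2) n))

twice-#codes : (n : ℕ) → 1 ≤ n → 2 * #codes (full {n + 2}) n false ≡ ⌈ n + 2 /2⌉ * ⌊ n + 2 /2⌋ * n !
twice-#codes 1 _ = refl
twice-#codes (suc (suc r)) _ = begin
  W + (W + 0)
    ≡⟨ cong (W +_) (trans (+-identityʳ W) (#codes-flip (full {m}) r false)) ⟩
  W + #codes (full {m}) (2 + r) true
    ≡⟨ #codes-total (full {m}) (2 + r) (trans (size-full m) (+-comm (2 + r) 2)) ⟩
  evens (full {m}) * odds (full {m}) * (2 + r) !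
    ≡⟨ cong₂ (λ e o → e * o * (2 + r) !) (evens-full m) (odds-full m) ⟩
  ⌈ m /2⌉ * ⌊ m /2⌋ * (2 + r) ! ∎
  where
  open ≡-Reasoning
  m = 2 + r + 2
  W = #codes (full {m}) (2 + r) false

twice-#arrangements : (n : ℕ) → 2 * #arrangements (full {n + 2}) n ≡ (2 + n) !
twice-#arrangements n =
  trans (*-comm 2 (#arrangements full n))
        (trans (#arrangements-count full n 2 (size-full (n + 2))) (cong _! (+-comm n 2)))

halve : {W T a b x y : ℕ} → 2 * W ≡ a → 2 * T ≡ b → a * x ≡ y * b → W * x ≡ y * T
halve {W} {T} {x = x} {y} refl refl ax≡yb = *-cancelˡ-≡ (W * x) (y * T) 2
  (trans (sym (*-assoc 2 W x))
         (trans ax≡yb (trans (sym (*-assoc y 2 T)) (trans (cong (_* T) (*-comm y 2)) (*-assoc 2 y T)))))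

open import Data.Integer using (+_)
open import Data.Rational using (ℚ; _/_) renaming (_+_ to _+ℚ_; _*_ to _*ℚ_; _≤_ to _≤ℚ_)

module _ where
  open import Data.Integer as ℤ using ()
  open import Data.Integer.Properties as ℤ using (pos-*; pos-+)
  import Data.Rational as ℚ
  import Data.Rational.Properties as ℚ
  open import Data.Rational.Unnormalised as ℚᵘ using (mkℚᵘ; *≡*)
  import Data.Rational.Unnormalised.Properties as ℚᵘ

  quarter-plus : (W T D : ℕ) .{{_ : NonZero D}} → W * (4 * D) ≡ (D + 4) * T →
                 nat→ℚ W ≡ ((+ 1) / 4 +ℚ (+ 1) / D) *ℚ nat→ℚ T
  quarter-plus W T (suc d) h =
    ℚ.toℚᵘ-injective (ℚᵘ.≃-trans (ℚᵘ.≃-trans (ℚ.toℚᵘ-fromℚᵘ (mkℚᵘ (+ W) 0)) (*≡* cross)) (ℚᵘ.≃-sym homo))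
    where
    q : ℚᵘ.ℚᵘ
    q = (mkℚᵘ (+ 1) 3 ℚᵘ.+ mkℚᵘ (+ 1) d) ℚᵘ.* mkℚᵘ (+ T) 0
    homo : ℚ.toℚᵘ (((+ 1) / 4 +ℚ (+ 1) / suc d) *ℚ nat→ℚ T) ℚᵘ.≃ q
    homo = ℚᵘ.≃-trans (ℚ.toℚᵘ-homo-* ((+ 1) / 4 +ℚ (+ 1) / suc d) (nat→ℚ T))
             (ℚᵘ.*-cong (ℚᵘ.≃-trans (ℚ.toℚᵘ-homo-+ ((+ 1) / 4) ((+ 1) / suc d))
                                    (ℚᵘ.+-cong (ℚ.toℚᵘ-fromℚᵘ (mkℚᵘ (+ 1) 3)) (ℚ.toℚᵘ-fromℚᵘ (mkℚᵘ (+ 1) d))))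
                        (ℚ.toℚᵘ-fromℚᵘ (mkℚᵘ (+ T) 0)))
    cross : + W ℤ.* + (4 * suc d * 1) ≡ (((+ 1) ℤ.* + suc d ℤ.+ (+ 1) ℤ.* + 4) ℤ.* + T) ℤ.* + 1
    cross = begin
      + W ℤ.* + (4 * suc d * 1)
        ≡⟨ sym (pos-* W (4 * suc d * 1)) ⟩
      + (W * (4 * suc d * 1))
        ≡⟨ cong +_ (trans (cong (W *_) (*-identityʳ (4 * suc d))) (trans h (sym (*-identityʳ _)))) ⟩
      + ((suc d + 4) * T * 1)
        ≡⟨ pos-* ((suc d + 4) * T) 1 ⟩
      + ((suc d + 4) * T) ℤ.* + 1
        ≡⟨ cong (ℤ._* + 1) (trans (pos-* (suc d + 4) T) (cong (ℤ._* + T) (pos-+ (suc d) 4))) ⟩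
      ((+ suc d ℤ.+ + 4) ℤ.* + T) ℤ.* + 1
        ≡⟨ cong (λ z → (z ℤ.* + T) ℤ.* + 1) (sym (cong₂ ℤ._+_ (ℤ.*-identityˡ (+ suc d)) (ℤ.*-identityˡ (+ 4)))) ⟩
      (((+ 1) ℤ.* + suc d ℤ.+ (+ 1) ℤ.* + 4) ℤ.* + T) ℤ.* + 1 ∎
      where open ≡-Reasoning

  quarter≤ : (D : ℕ) .{{_ : NonZero D}} → (+ 1) / 4 ≤ℚ (+ 1) / 4 +ℚ (+ 1) / D
  quarter≤ D = subst (_≤ℚ (+ 1) / 4 +ℚ (+ 1) / D) (ℚ.+-identityʳ ((+ 1) / 4))
                     (ℚ.+-monoʳ-≤ ((+ 1) / 4) (ℚ.nonNegative⁻¹ ((+ 1) / D) {{ℚ.normalize-nonNeg 1 D}}))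

-- The hypothesis says E·O / ((n + 1)(n + 2)) = 1/4 + 1/D, with E, O the numbers of even and odd
-- colours.
successProb : (n : ℕ) → 1 ≤ n → (D : ℕ) .{{_ : NonZero D}} →
              ⌈ n + 2 /2⌉ * ⌊ n + 2 /2⌋ * (4 * D) ≡ (D + 4) * ((2 + n) * (1 + n)) →
              SuccessProb n 2 (strategy n) ((+ 1) / 4 +ℚ (+ 1) / D)
successProb n 1≤n D h =
  subst₂ (λ W T → nat→ℚ W ≡ ((+ 1) / 4 +ℚ (+ 1) / D) *ℚ nat→ℚ T)
         (sym (winCount≡#codes n 1≤n)) (sym (#assignments n))
         (quarter-plus W T D (halve {W} {T} {x = 4 * D} {D + 4} (twice-#codes n 1≤n) (twice-#arrangements n) cross))
  where
  W = #codes (full {n + 2}) n false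
  T = #arrangements (full {n + 2}) n
  E = ⌈ n + 2 /2⌉
  O = ⌊ n + 2 /2⌋
  cross : E * O * n ! * (4 * D) ≡ (D + 4) * (2 + n) !
  cross = begin
    E * O * n ! * (4 * D)               ≡⟨ swap (E * O) (n !) (4 * D) ⟩
    E * O * (4 * D) * n !               ≡⟨ cong (_* n !) h ⟩
    (D + 4) * ((2 + n) * (1 + n)) * n ! ≡⟨ regroup (D + 4) (2 + n) (1 + n) (n !) ⟩
    (D + 4) * (2 + n) !                 ∎
    where
    open ≡-Reasoning
    swap : ∀ a b c → a * b * c ≡ a * c * b
    swap = solve-∀
    regroup : ∀ y a b c → y * (a * b) * c ≡ y * (a * (b * c))
    regroup = solve-∀

even-or-odd : (n : ℕ) → (∃ λ j → n ≡ j + j) ⊎ (∃ λ j → n ≡ suc (j + j))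
even-or-odd zero    = inj₁ (0 , refl)
even-or-odd (suc n) with even-or-odd n
... | inj₁ (j , refl) = inj₂ (j , refl)
... | inj₂ (j , refl) = inj₁ (suc j , cong suc (sym (+-suc j j)))

⌊n+2/2⌋ : (m : ℕ) → ⌊ m + 2 /2⌋ ≡ suc ⌊ m /2⌋
⌊n+2/2⌋ zero          = refl
⌊n+2/2⌋ (suc zero)    = refl
⌊n+2/2⌋ (suc (suc m)) = cong suc (⌊n+2/2⌋ m)

⌊1+n+n/2⌋ : (j : ℕ) → ⌊ suc (j + j) /2⌋ ≡ j
⌊1+n+n/2⌋ zero    = refl
⌊1+n+n/2⌋ (suc j) = cong suc (trans (cong ⌊_/2⌋ (+-suc j j)) (⌊1+n+n/2⌋ j))

evens·odds-even : (j : ℕ) → let n = j + j in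
                  ⌈ n + 2 /2⌉ * ⌊ n + 2 /2⌋ * (4 * (4 * (1 + n))) ≡ (4 * (1 + n) + 4) * ((2 + n) * (1 + n))
evens·odds-even j =
  trans (cong₂ (λ e o → e * o * (4 * (4 * (1 + (j + j)))))
               (trans (⌊n+2/2⌋ (suc (j + j))) (cong suc (⌊1+n+n/2⌋ j)))
               (trans (⌊n+2/2⌋ (j + j)) (cong suc (sym (n≡⌊n+n/2⌋ j)))))
        (polynomial j)
  where
  polynomial : ∀ j → suc j * suc j * (4 * (4 * (1 + (j + j)))) ≡
                     (4 * (1 + (j + j)) + 4) * ((2 + (j + j)) * (1 + (j + j)))
  polynomial = solve-∀

evens·odds-odd : (j : ℕ) → let n = suc (j + j) in
                 ⌈ n + 2 /2⌉ * ⌊ n + 2 /2⌋ * (4 * (4 * (2 + n))) ≡ (4 * (2 + n) + 4) * ((2 + n) * (1 + n))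
evens·odds-odd j =
  trans (cong₂ (λ e o → e * o * (4 * (4 * (2 + suc (j + j)))))
               (trans (⌊n+2/2⌋ (suc (suc (j + j)))) (cong (λ m → suc (suc m)) (sym (n≡⌊n+n/2⌋ j))))
               (trans (⌊n+2/2⌋ (suc (j + j))) (cong suc (⌊1+n+n/2⌋ j))))
        (polynomial j)
  where
  polynomial : ∀ j → suc (suc j) * suc j * (4 * (4 * (2 + suc (j + j)))) ≡
                     (4 * (2 + suc (j + j)) + 4) * ((2 + suc (j + j)) * (1 + suc (j + j)))
  polynomial = solve-∀

2∣j+j : (j : ℕ) → 2 ∣ j + j
2∣j+j j = divides j (trans (cong (λ m → j + m) (sym (+-identityʳ j))) (*-comm 2 j))

2∤1+j+j : (j : ℕ) → ¬ 2 ∣ suc (j + j)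
2∤1+j+j j 2∣1+j+j with ∣1⇒≡1 (∣m+n∣m⇒∣n (subst (2 ∣_) (+-comm 1 (j + j)) 2∣1+j+j) (2∣j+j j))
... | ()

mainTheorem3 : (n : ℕ) → 1 ≤ n →
    Σ (Strategy (n + 2)) λ s → Σ ℚ λ p →
    SuccessProb n 2 s p
    × (2 ∣ n → p ≡ ((+ 1) / 4) +ℚ ((+ 1) / (4 * (1 + n))))
    × (¬ (2 ∣ n) → p ≡ ((+ 1) / 4) +ℚ ((+ 1) / (4 * (2 + n))))
    × ((+ 1) / 4 ≤ℚ p)
mainTheorem3 n 1≤n with even-or-odd n
... | inj₁ (j , refl) =
  strategy n , _ , successProb n 1≤n (4 * (1 + n)) (evens·odds-even j) ,
  (λ _ → refl) , (λ 2∤n → ⊥-elim (2∤n (2∣j+j j))) , quarter≤ (4 * (1 + n))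
... | inj₂ (j , refl) =
  strategy n , _ , successProb n 1≤n (4 * (2 + n)) (evens·odds-odd j) ,
  (λ 2∣n → ⊥-elim (2∤1+j+j j 2∣n)) , (λ _ → refl) , quarter≤ (4 * (2 + n))
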